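{- Suppose that $M$ is loopless. Then \[ \sum_{F \in \widehat{\mathcal{L}}} (\#F)\, \overline{\chi}_{M/F}(q) = (\#E)[\operatorname{rk}(M) - 1]_q. \]
   Context: $M$ is a matroid on ground set $E$ with lattice of flats $\mathcal{L}$, $\widehat{\mathcal{L}}=\mathcal{L}\setminus\{E,\operatorname{cl}(\emptyset)\}$, $\overline{\chi}_N(q)=\chi_N(q)/(q-1)$ is the reduced characteristic polynomial, and $[n]_q=1+q+\dots+q^{n-1}$. -}

module Defs where

open import Data.Nat as ℕ using (ℕ; zero; suc; _≤_; _<_; _∸_)
open import Data.Integer as ℤ using (ℤ; +_; -_)
open import Data.Bool using (Bool; true; false; _∧_; _∨_; not; if_then_else_)
open import Data.Fin using (Fin)
open import Data.Vec using (Vec; []; _∷_; map)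
open import Data.List as L using (List; []; _∷_; _++_; filter; foldr)
open import Data.Fin.Subset using (Subset; _⊆_; _∪_; _∩_; _─_; ∣_∣; ⁅_⁆; ⊤; ⊥; inside; outside)
open import Relation.Nullary.Decidable using (Dec; yes; no)
open import Relation.Unary using (Decidable)
open import Data.Nat.Properties using (_<?_)

record Matroid (n : ℕ) : Set where
  field
    rk         : Subset n → ℕ
    rk-bounded : ∀ A → rk A ≤ ∣ A ∣
    rk-mono    : ∀ {A B} → A ⊆ B → rk A ≤ rk B
    rk-submod  : ∀ A B → rk (A ∪ B) ℕ.+ rk (A ∩ B) ≤ rk A ℕ.+ rk B
open Matroid public

Loopless : ∀ {n} → Matroid n → Set
Loopless {n} M = ∀ (x : Fin n) → rk M ⁅ x ⁆ ≡ 1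
  where open import Relation.Binary.PropositionalEquality using (_≡_)

allSubsets : ∀ n → List (Subset n)
allSubsets zero    = [] ∷ []
allSubsets (suc n) = L.map (outside ∷_) (allSubsets n) ++ L.map (inside ∷_) (allSubsets n)

allFin : ∀ n → List (Fin n)
allFin zero    = []
allFin (suc n) = Fin.zero ∷ L.map Fin.suc (allFin n)
  where import Data.Fin as Fin

subsetsOf : ∀ {n} → Subset n → List (Subset n)
subsetsOf {n} G = filter (λ A → isSub A G) (allSubsets n)
  where
  isSub : ∀ {m} (A B : Subset m) → Dec (A ⊆ B)
  isSub A B = Data.Fin.Subset.Properties._⊆?_ A B
    where import Data.Fin.Subset.Properties

_==_ : ∀ {n} → Subset n → Subset n → Bool
[] == [] = true
(a ∷ as) == (b ∷ bs) = eqB a b ∧ (as == bs)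
  where
  eqB : Bool → Bool → Bool
  eqB true  true  = true
  eqB false false = true
  eqB _     _     = false

_∈ᵇ_ : ∀ {n} → Fin n → Subset n → Bool
x ∈ᵇ A = Data.Vec.lookup A x
  where import Data.Vec

ltᵇ : ℕ → ℕ → Bool
ltᵇ m k with m <? k
... | yes _ = true
... | no  _ = false

eqℕᵇ : ℕ → ℕ → Bool
eqℕᵇ m k with m ℕ.≟ k
... | yes _ = true
... | no  _ = false

allᵇ : ∀ {A : Set} → (A → Bool) → List A → Bool
allᵇ p = foldr (λ a b → p a ∧ b) true

anyᵇ : ∀ {A : Set} → (A → Bool) → List A → Bool
anyᵇ p = foldr (λ a b → p a ∨ b) false

isFlat : ∀ {n} → Matroid n → Subset n → Bool
isFlat {n} M F = allᵇ (λ x → (x ∈ᵇ F) ∨ ltᵇ (rk M F) (rk M (F ∪ ⁅ x ⁆))) (allFin n)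

cl : ∀ {n} → Matroid n → Subset n → Subset n
cl {n} M A = Data.Vec.tabulate (λ x → eqℕᵇ (rk M (A ∪ ⁅ x ⁆)) (rk M A))
  where import Data.Vec

LHat : ∀ {n} → Matroid n → List (Subset n)
LHat {n} M = L.filter (λ F → T? (isFlat M F ∧ not (F == ⊤) ∧ not (F == cl M ⊥))) (allSubsets n)
  where
  open import Data.Bool using (T)
  T? : (b : Bool) → Dec (T b)
  T? = Data.Bool.T?
    where import Data.Bool

-- Integer polynomials as coefficient lists (constant term first)

Poly : Set
Poly = List ℤ

_+ₚ_ : Poly → Poly → Poly
[]       +ₚ q        = q
(a ∷ p)  +ₚ []       = a ∷ p
(a ∷ p)  +ₚ (b ∷ q)  = (a ℤ.+ b) ∷ (p +ₚ q)

scaleₚ : ℤ → Poly → Poly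
scaleₚ c = L.map (c ℤ.*_)

monomial : ℕ → Poly
monomial zero    = + 1 ∷ []
monomial (suc k) = + 0 ∷ monomial k

sumₚ : List Poly → Poly
sumₚ = foldr _+ₚ_ []

eval : Poly → ℤ → ℤ
eval p q = foldr (λ a acc → a ℤ.+ q ℤ.* acc) (+ 0) p

-- quotient of p by (q - 1) (synthetic division; remainder p(1) discarded)
divByQminus1 : Poly → Poly
divByQminus1 []      = []
divByQminus1 (_ ∷ p) = suffixSums p
  where
  suffixSums : Poly → Poly
  suffixSums []       = []
  suffixSums (b ∷ bs) = (b ℤ.+ L.foldr ℤ._+_ (+ 0) bs) ∷ suffixSums bs

sign : ℕ → ℤ
sign zero    = + 1
sign (suc k) = - sign k

charPolyOn : ∀ {n} → Subset n → (Subset n → ℕ) → Poly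
charPolyOn G r = sumₚ (L.map (λ A → scaleₚ (sign ∣ A ∣) (monomial (r G ∸ r A))) (subsetsOf G))

contractRk : ∀ {n} → Matroid n → Subset n → Subset n → ℕ
contractRk M F A = rk M (A ∪ F) ∸ rk M F

charPolyContract : ∀ {n} → Matroid n → Subset n → Poly
charPolyContract M F = charPolyOn (⊤ ─ F) (contractRk M F)

redCharPolyContract : ∀ {n} → Matroid n → Subset n → Poly
redCharPolyContract M F = divByQminus1 (charPolyContract M F)

qInt : ℕ → ℤ → ℤ
qInt zero    q = + 0
qInt (suc k) q = + 1 ℤ.+ q ℤ.* qInt k q

lhs : ∀ {n} → Matroid n → ℤ → ℤ
lhs M q = L.foldr ℤ._+_ (+ 0) (L.map (λ F → + ∣ F ∣ ℤ.* eval (redCharPolyContract M F) q) (LHat M))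

-- Put g(B) = [rk E − rk B]_q. Evaluating the quotient of Σ aᵢ qⁱ by q − 1 amounts to replacing
-- each qⁱ by [i]_q, so χ̄_{M/F}(q) = Σ_{A ⊆ E∖F} (−1)^{|A|} g(A ∪ F) for every F ⊆ E. This
-- alternating sum vanishes when F is not a flat (toggling an element of cl(F) ∖ F is a
-- sign-reversing involution preserving rank) and when F = E (as g(E) = 0), while cl(∅) = ∅
-- contributes with weight #∅ = 0. Hence the left-hand side is Σ_{F ⊆ E} #F Σ_{B ⊇ F} (−1)^{|B∖F|} g(B),
-- and since Σ_{F ⊆ B} #F (−1)^{|B∖F|} is 1 for singletons B and 0 otherwise, this is
-- Σ_{e ∈ E} g({e}) = #E [rk M − 1]_q.
module Submission where

open import Defs
open import Data.Nat as ℕ using (ℕ; zero; suc; _∸_; _≤_)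
import Data.Nat.Properties as ℕP
open import Data.Integer as ℤ using (ℤ; +_; -_; _+_; _*_)
import Data.Integer.Properties as ℤP
open import Data.Integer.Tactic.RingSolver using (solve-∀)
open import Data.Bool using (true; false; if_then_else_; not; _∧_; _∨_)
open import Data.Bool.Properties using (∨-zeroʳ)
open import Data.List as L using (List; []; _∷_; _++_)
import Data.List.Properties as LP
open import Data.Vec using ([]; _∷_; lookup; tabulate)
open import Data.Fin using (Fin; zero; suc)
open import Data.Fin.Subset using (Subset; _∪_; _∩_; _─_; ∣_∣; ⁅_⁆; ⊤; ⊥; inside; outside)
open import Data.Fin.Subset.Properties
  using (_⊆?_; p⊆p∪q; q⊆p∪q; x∈p∩q⁺; ∣⊥∣≡0; ∪-identityˡ; ∪-assoc; ∪-idem)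
open import Data.Product using (∃; _×_; _,_)
open import Function using (_∘_)
open import Relation.Nullary using (does; yes; no)
open import Relation.Unary using (Decidable)
open import Relation.Binary.PropositionalEquality

sumℤ : List ℤ → ℤ
sumℤ = L.foldr _+_ (+ 0)

sumℤ-++ : ∀ xs ys → sumℤ (xs ++ ys) ≡ sumℤ xs + sumℤ ys
sumℤ-++ []       ys = sym (ℤP.+-identityˡ _)
sumℤ-++ (x ∷ xs) ys = trans (cong (λ z → x + z) (sumℤ-++ xs ys)) (sym (ℤP.+-assoc x _ _))

module _ {A : Set} where

  sumℤ-map-cong : ∀ {f g : A → ℤ} → (∀ a → f a ≡ g a) → ∀ xs →
    sumℤ (L.map f xs) ≡ sumℤ (L.map g xs)
  sumℤ-map-cong f≗g []       = refl
  sumℤ-map-cong f≗g (x ∷ xs) = cong₂ _+_ (f≗g x) (sumℤ-map-cong f≗g xs)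

  sumℤ-map-+ : ∀ (f g : A → ℤ) xs →
    sumℤ (L.map (λ a → f a + g a) xs) ≡ sumℤ (L.map f xs) + sumℤ (L.map g xs)
  sumℤ-map-+ f g []       = refl
  sumℤ-map-+ f g (x ∷ xs) =
    trans (cong (λ z → f x + g x + z) (sumℤ-map-+ f g xs)) (interchange (f x) (g x) _ _)
    where
    interchange : ∀ a b c d → a + b + (c + d) ≡ (a + c) + (b + d)
    interchange = solve-∀

  sumℤ-map-neg : ∀ (f : A → ℤ) xs → sumℤ (L.map (λ a → - f a) xs) ≡ - sumℤ (L.map f xs)
  sumℤ-map-neg f []       = refl
  sumℤ-map-neg f (x ∷ xs) =
    trans (cong (λ z → - f x + z) (sumℤ-map-neg f xs)) (sym (ℤP.neg-distrib-+ (f x) _))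

  sumℤ-map-0 : ∀ (xs : List A) → sumℤ (L.map (λ _ → + 0) xs) ≡ + 0
  sumℤ-map-0 []       = refl
  sumℤ-map-0 (x ∷ xs) = trans (ℤP.+-identityˡ _) (sumℤ-map-0 xs)

  sumℤ-map-filter : ∀ {P : A → Set} (P? : Decidable P) (f : A → ℤ) xs →
    sumℤ (L.map f (L.filter P? xs)) ≡ sumℤ (L.map (λ a → if does (P? a) then f a else + 0) xs)
  sumℤ-map-filter P? f []       = refl
  sumℤ-map-filter P? f (x ∷ xs) with does (P? x)
  ... | true  = cong (λ z → f x + z) (sumℤ-map-filter P? f xs)
  ... | false = trans (sumℤ-map-filter P? f xs) (sym (ℤP.+-identityˡ _))

module _ (q : ℤ) where

  qIntEval : ℕ → Poly → ℤ
  qIntEval k []      = + 0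
  qIntEval k (a ∷ p) = a * qInt k q + qIntEval (suc k) p

  qIntEval-suc : ∀ k p → qIntEval (suc k) p ≡ sumℤ p + q * qIntEval k p
  qIntEval-suc k []       = sym (trans (ℤP.+-identityˡ _) (ℤP.*-zeroʳ q))
  qIntEval-suc k (b ∷ bs) =
    trans (cong (λ z → b * qInt (suc k) q + z) (qIntEval-suc (suc k) bs))
          (regroup b (sumℤ bs) (qInt k q) (qIntEval (suc k) bs) q)
    where
    regroup : ∀ b s Q P x → b * (+ 1 + x * Q) + (s + x * P) ≡ (b + s) + x * (b * Q + P)
    regroup = solve-∀

  private
    eval-divByQminus1-∷ : ∀ a p → eval (divByQminus1 (a ∷ p)) q ≡ qIntEval 1 p
    eval-divByQminus1-∷ a []       = refl
    eval-divByQminus1-∷ a (b ∷ bs) = begin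
      (b + sumℤ bs) + q * eval (divByQminus1 (a ∷ bs)) q
        ≡⟨ cong (λ z → (b + sumℤ bs) + q * z) (eval-divByQminus1-∷ a bs) ⟩
      (b + sumℤ bs) + q * qIntEval 1 bs
        ≡⟨ regroup b (sumℤ bs) (qIntEval 1 bs) q ⟩
      b * qInt 1 q + (sumℤ bs + q * qIntEval 1 bs)
        ≡⟨ cong (λ z → b * qInt 1 q + z) (qIntEval-suc 1 bs) ⟨
      b * qInt 1 q + qIntEval 2 bs ∎
      where
      open ≡-Reasoning
      regroup : ∀ b s P x → (b + s) + x * P ≡ b * (+ 1 + x * + 0) + (s + x * P)
      regroup = solve-∀

  -- Since qⁱ = (q − 1) [i]_q + 1, dividing by q − 1 replaces each qⁱ by [i]_q.
  eval-divByQminus1 : ∀ p → eval (divByQminus1 p) q ≡ qIntEval 0 p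
  eval-divByQminus1 []      = refl
  eval-divByQminus1 (a ∷ p) =
    trans (eval-divByQminus1-∷ a p)
          (sym (trans (cong (_+ qIntEval 1 p) (ℤP.*-zeroʳ a)) (ℤP.+-identityˡ _)))

  qIntEval-+ₚ : ∀ k p p′ → qIntEval k (p +ₚ p′) ≡ qIntEval k p + qIntEval k p′
  qIntEval-+ₚ k []      p′       = sym (ℤP.+-identityˡ _)
  qIntEval-+ₚ k (a ∷ p) []       = sym (ℤP.+-identityʳ _)
  qIntEval-+ₚ k (a ∷ p) (b ∷ p′) =
    trans (cong (λ z → (a + b) * qInt k q + z) (qIntEval-+ₚ (suc k) p p′))
          (regroup a b (qInt k q) (qIntEval (suc k) p) (qIntEval (suc k) p′))
    where
    regroup : ∀ a b Q x y → (a + b) * Q + (x + y) ≡ (a * Q + x) + (b * Q + y)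
    regroup = solve-∀

  qIntEval-scaleₚ : ∀ k c p → qIntEval k (scaleₚ c p) ≡ c * qIntEval k p
  qIntEval-scaleₚ k c []      = sym (ℤP.*-zeroʳ c)
  qIntEval-scaleₚ k c (a ∷ p) =
    trans (cong (λ z → c * a * qInt k q + z) (qIntEval-scaleₚ (suc k) c p))
          (regroup c a (qInt k q) (qIntEval (suc k) p))
    where
    regroup : ∀ c a Q x → c * a * Q + c * x ≡ c * (a * Q + x)
    regroup = solve-∀

  qIntEval-monomial : ∀ k m → qIntEval k (monomial m) ≡ qInt (m ℕ.+ k) q
  qIntEval-monomial k zero    = trans (ℤP.+-identityʳ _) (ℤP.*-identityˡ _)
  qIntEval-monomial k (suc m) =
    trans (ℤP.+-identityˡ _)
          (trans (qIntEval-monomial (suc k) m) (cong (λ i → qInt i q) (ℕP.+-suc m k)))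

  qIntEval-sumₚ : ∀ {A : Set} k (f : A → Poly) xs →
    qIntEval k (sumₚ (L.map f xs)) ≡ sumℤ (L.map (qIntEval k ∘ f) xs)
  qIntEval-sumₚ k f []       = refl
  qIntEval-sumₚ k f (x ∷ xs) =
    trans (qIntEval-+ₚ k (f x) _) (cong (λ z → qIntEval k (f x) + z) (qIntEval-sumₚ k f xs))

sumSubsets : ∀ n → (Subset n → ℤ) → ℤ
sumSubsets n h = sumℤ (L.map h (allSubsets n))

module _ (n : ℕ) where

  sumSubsets-cong : ∀ {f g : Subset n → ℤ} → (∀ A → f A ≡ g A) → sumSubsets n f ≡ sumSubsets n g
  sumSubsets-cong f≗g = sumℤ-map-cong f≗g (allSubsets n)

  sumSubsets-+ : ∀ (f g : Subset n → ℤ) → sumSubsets n (λ A → f A + g A) ≡ sumSubsets n f + sumSubsets n g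
  sumSubsets-+ f g = sumℤ-map-+ f g (allSubsets n)

  sumSubsets-neg : ∀ (f : Subset n → ℤ) → sumSubsets n (λ A → - f A) ≡ - sumSubsets n f
  sumSubsets-neg f = sumℤ-map-neg f (allSubsets n)

  sumSubsets-0 : sumSubsets n (λ _ → + 0) ≡ + 0
  sumSubsets-0 = sumℤ-map-0 (allSubsets n)

sumSubsets-suc : ∀ n h → sumSubsets (suc n) h ≡
  sumSubsets n (λ A → h (outside ∷ A)) + sumSubsets n (λ A → h (inside ∷ A))
sumSubsets-suc n h = begin
  sumℤ (L.map h (L.map (outside ∷_) S ++ L.map (inside ∷_) S))
    ≡⟨ cong sumℤ (LP.map-++ h (L.map (outside ∷_) S) _) ⟩
  sumℤ (L.map h (L.map (outside ∷_) S) ++ L.map h (L.map (inside ∷_) S))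
    ≡⟨ sumℤ-++ (L.map h (L.map (outside ∷_) S)) _ ⟩
  sumℤ (L.map h (L.map (outside ∷_) S)) + sumℤ (L.map h (L.map (inside ∷_) S))
    ≡⟨ cong₂ _+_ (cong sumℤ (LP.map-∘ S)) (cong sumℤ (LP.map-∘ S)) ⟨
  sumSubsets n (λ A → h (outside ∷ A)) + sumSubsets n (λ A → h (inside ∷ A)) ∎
  where
  open ≡-Reasoning
  S = allSubsets n

alternatingSumAbove : ∀ {n} → (Subset n → ℤ) → Subset n → ℤ
alternatingSumAbove {n} g X =
  sumSubsets n (λ A → if does (A ⊆? (⊤ ─ X)) then sign ∣ A ∣ * g (A ∪ X) else + 0)

module _ {n : ℕ} (g : Subset (suc n) → ℤ) where

  alternatingSumAbove-outside : ∀ X → alternatingSumAbove g (outside ∷ X) ≡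
    alternatingSumAbove (g ∘ (outside ∷_)) X + - alternatingSumAbove (g ∘ (inside ∷_)) X
  alternatingSumAbove-outside X =
    trans (sumSubsets-suc n _)
          (cong (_+_ (alternatingSumAbove (g ∘ (outside ∷_)) X))
                (trans (sumSubsets-cong n negate-term) (sumSubsets-neg n _)))
    where
    negate-term : ∀ A → (if does (A ⊆? (⊤ ─ X)) then - sign ∣ A ∣ * g (inside ∷ A ∪ X) else + 0)
                      ≡ - (if does (A ⊆? (⊤ ─ X)) then sign ∣ A ∣ * g (inside ∷ A ∪ X) else + 0)
    negate-term A with does (A ⊆? (⊤ ─ X))
    ... | true  = sym (ℤP.neg-distribˡ-* (sign ∣ A ∣) _)
    ... | false = refl

  alternatingSumAbove-inside : ∀ X →
    alternatingSumAbove g (inside ∷ X) ≡ alternatingSumAbove (g ∘ (inside ∷_)) X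
  alternatingSumAbove-inside X =
    trans (sumSubsets-suc n _)
          (trans (cong (_+_ (alternatingSumAbove (g ∘ (inside ∷_)) X)) (sumSubsets-0 n)) (ℤP.+-identityʳ _))

alternatingSumAbove-⊤ : ∀ n (g : Subset n → ℤ) → alternatingSumAbove g ⊤ ≡ g ⊤
alternatingSumAbove-⊤ zero    g = trans (ℤP.+-identityʳ _) (ℤP.*-identityˡ (g []))
alternatingSumAbove-⊤ (suc n) g =
  trans (alternatingSumAbove-inside g ⊤) (alternatingSumAbove-⊤ n (g ∘ (inside ∷_)))

sum-alternatingSumAbove : ∀ n (g : Subset n → ℤ) → sumSubsets n (alternatingSumAbove g) ≡ g ⊥
sum-alternatingSumAbove zero    g = trans (ℤP.+-identityʳ _) (alternatingSumAbove-⊤ zero g)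
sum-alternatingSumAbove (suc n) g = begin
  sumSubsets (suc n) (alternatingSumAbove g)
    ≡⟨ sumSubsets-suc n _ ⟩
  sumSubsets n (alternatingSumAbove g ∘ (outside ∷_)) + sumSubsets n (alternatingSumAbove g ∘ (inside ∷_))
    ≡⟨ cong₂ _+_ (trans (sumSubsets-cong n (alternatingSumAbove-outside g)) (sumSubsets-+ n _ _))
                 (sumSubsets-cong n (alternatingSumAbove-inside g)) ⟩
  (sumSubsets n (alternatingSumAbove g₀) + sumSubsets n (λ X → - alternatingSumAbove g₁ X))
    + sumSubsets n (alternatingSumAbove g₁)
    ≡⟨ cong (λ z → (sumSubsets n (alternatingSumAbove g₀) + z) + sumSubsets n (alternatingSumAbove g₁))
            (sumSubsets-neg n _) ⟩
  (sumSubsets n (alternatingSumAbove g₀) + - sumSubsets n (alternatingSumAbove g₁))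
    + sumSubsets n (alternatingSumAbove g₁)
    ≡⟨ cancel _ _ ⟩
  sumSubsets n (alternatingSumAbove g₀)
    ≡⟨ sum-alternatingSumAbove n g₀ ⟩
  g ⊥ ∎
  where
  open ≡-Reasoning
  g₀ g₁ : Subset n → ℤ
  g₀ = g ∘ (outside ∷_)
  g₁ = g ∘ (inside ∷_)
  cancel : ∀ a b → (a + - b) + b ≡ a
  cancel = solve-∀

sumSingletons : ∀ n → (Subset n → ℤ) → ℤ
sumSingletons zero    g = + 0
sumSingletons (suc n) g = g ⁅ zero ⁆ + sumSingletons n (g ∘ (outside ∷_))

sumSingletons-const : ∀ n (g : Subset n → ℤ) c → (∀ i → g ⁅ i ⁆ ≡ c) → sumSingletons n g ≡ + n * c
sumSingletons-const zero    g c g⁅⁆≡c = refl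
sumSingletons-const (suc n) g c g⁅⁆≡c =
  trans (cong₂ _+_ (g⁅⁆≡c zero) (sumSingletons-const n _ c (g⁅⁆≡c ∘ suc))) (regroup c (+ n))
  where
  regroup : ∀ c m → c + m * c ≡ (+ 1 + m) * c
  regroup = solve-∀

-- Σ_{X ⊆ B} #X (−1)^{|B ∖ X|} is 1 if #B = 1 and 0 otherwise.
sum-size*alternatingSumAbove : ∀ n (g : Subset n → ℤ) →
  sumSubsets n (λ X → + ∣ X ∣ * alternatingSumAbove g X) ≡ sumSingletons n g
sum-size*alternatingSumAbove zero    g = refl
sum-size*alternatingSumAbove (suc n) g = begin
  sumSubsets (suc n) (λ X → + ∣ X ∣ * alternatingSumAbove g X)
    ≡⟨ sumSubsets-suc n _ ⟩
  sumSubsets n (λ X → + ∣ X ∣ * alternatingSumAbove g (outside ∷ X))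
    + sumSubsets n (λ X → + suc ∣ X ∣ * alternatingSumAbove g (inside ∷ X))
    ≡⟨ sumSubsets-+ n _ _ ⟨
  sumSubsets n (λ X → + ∣ X ∣ * alternatingSumAbove g (outside ∷ X)
                    + + suc ∣ X ∣ * alternatingSumAbove g (inside ∷ X))
    ≡⟨ sumSubsets-cong n split ⟩
  sumSubsets n (λ X → + ∣ X ∣ * alternatingSumAbove g₀ X + alternatingSumAbove g₁ X)
    ≡⟨ sumSubsets-+ n _ _ ⟩
  sumSubsets n (λ X → + ∣ X ∣ * alternatingSumAbove g₀ X) + sumSubsets n (alternatingSumAbove g₁)
    ≡⟨ cong₂ _+_ (sum-size*alternatingSumAbove n g₀) (sum-alternatingSumAbove n g₁) ⟩
  sumSingletons n g₀ + g₁ ⊥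
    ≡⟨ ℤP.+-comm (sumSingletons n g₀) _ ⟩
  sumSingletons (suc n) g ∎
  where
  open ≡-Reasoning
  g₀ g₁ : Subset n → ℤ
  g₀ = g ∘ (outside ∷_)
  g₁ = g ∘ (inside ∷_)
  regroup : ∀ m a b → m * (a + - b) + (+ 1 + m) * b ≡ m * a + b
  regroup = solve-∀
  split : ∀ X → + ∣ X ∣ * alternatingSumAbove g (outside ∷ X)
                + + suc ∣ X ∣ * alternatingSumAbove g (inside ∷ X)
              ≡ + ∣ X ∣ * alternatingSumAbove g₀ X + alternatingSumAbove g₁ X
  split X rewrite alternatingSumAbove-outside g X | alternatingSumAbove-inside g X | ℤP.pos-+ 1 ∣ X ∣ =
    regroup (+ ∣ X ∣) (alternatingSumAbove g₀ X) (alternatingSumAbove g₁ X)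

toggle : ∀ {n} → Fin n → Subset n → Subset n
toggle zero    (b ∷ A) = not b ∷ A
toggle (suc y) (b ∷ A) = b ∷ toggle y A

sumSubsets-toggle : ∀ n (y : Fin n) (h : Subset n → ℤ) → sumSubsets n h ≡ sumSubsets n (h ∘ toggle y)
sumSubsets-toggle (suc n) zero h =
  trans (sumSubsets-suc n h)
        (trans (ℤP.+-comm (sumSubsets n (h ∘ (outside ∷_))) _) (sym (sumSubsets-suc n (h ∘ toggle zero))))
sumSubsets-toggle (suc n) (suc y) h =
  trans (sumSubsets-suc n h)
        (trans (cong₂ _+_ (sumSubsets-toggle n y (h ∘ (outside ∷_)))
                          (sumSubsets-toggle n y (h ∘ (inside ∷_))))
               (sym (sumSubsets-suc n (h ∘ toggle (suc y)))))

sign-∣toggle∣ : ∀ {n} (y : Fin n) A → sign ∣ toggle y A ∣ ≡ - sign ∣ A ∣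
sign-∣toggle∣ zero    (true  ∷ A) = sym (ℤP.neg-involutive _)
sign-∣toggle∣ zero    (false ∷ A) = refl
sign-∣toggle∣ (suc y) (true  ∷ A) = cong -_ (sign-∣toggle∣ y A)
sign-∣toggle∣ (suc y) (false ∷ A) = sign-∣toggle∣ y A

toggle-⊆? : ∀ {n} (y : Fin n) A G → lookup G y ≡ true → does (toggle y A ⊆? G) ≡ does (A ⊆? G)
toggle-⊆? zero    (true  ∷ A) (true  ∷ G) y∈G = refl
toggle-⊆? zero    (false ∷ A) (true  ∷ G) y∈G = refl
toggle-⊆? (suc y) (true  ∷ A) (true  ∷ G) y∈G = toggle-⊆? y A G y∈G
toggle-⊆? (suc y) (true  ∷ A) (false ∷ G) y∈G = refl
toggle-⊆? (suc y) (false ∷ A) (b     ∷ G) y∈G = toggle-⊆? y A G y∈G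

toggle-∪-⁅⁆ : ∀ {n} (y : Fin n) A F → (toggle y A ∪ F) ∪ ⁅ y ⁆ ≡ (A ∪ F) ∪ ⁅ y ⁆
toggle-∪-⁅⁆ zero    (a ∷ A) (x ∷ F) = cong (_∷ (A ∪ F) ∪ ⊥) (trans (∨-zeroʳ _) (sym (∨-zeroʳ _)))
toggle-∪-⁅⁆ (suc y) (a ∷ A) (x ∷ F) = cong (((a ∨ x) ∨ false) ∷_) (toggle-∪-⁅⁆ y A F)

∈-⊤─ : ∀ {n} (F : Subset n) y → lookup F y ≡ false → lookup (⊤ ─ F) y ≡ true
∈-⊤─ (false ∷ F) zero    y∉F = refl
∈-⊤─ (b     ∷ F) (suc y) y∉F = ∈-⊤─ F y y∉F

⊤─p∪p≡⊤ : ∀ {n} (F : Subset n) → (⊤ ─ F) ∪ F ≡ ⊤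
⊤─p∪p≡⊤ []          = refl
⊤─p∪p≡⊤ (true  ∷ F) = cong (true ∷_) (⊤─p∪p≡⊤ F)
⊤─p∪p≡⊤ (false ∷ F) = cong (true ∷_) (⊤─p∪p≡⊤ F)

x≡-x⇒x≡0 : ∀ (x : ℤ) → x ≡ - x → x ≡ + 0
x≡-x⇒x≡0 (+ zero)   _  = refl
x≡-x⇒x≡0 (+ suc n)  ()
x≡-x⇒x≡0 ℤ.-[1+ n ] ()

∸-∸-cancel : ∀ a b c → c ≤ b → (a ∸ c) ∸ (b ∸ c) ≡ a ∸ b
∸-∸-cancel a b c c≤b = trans (ℕP.∸-+-assoc a c (b ∸ c)) (cong (a ∸_) (ℕP.m+[n∸m]≡n c≤b))

==⇒≡ : ∀ {n} (F G : Subset n) → (F == G) ≡ true → F ≡ G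
==⇒≡ []          []          _ = refl
==⇒≡ (true  ∷ F) (true  ∷ G) e = cong (true ∷_) (==⇒≡ F G e)
==⇒≡ (false ∷ F) (false ∷ G) e = cong (false ∷_) (==⇒≡ F G e)
==⇒≡ (true  ∷ F) (false ∷ G) ()
==⇒≡ (false ∷ F) (true  ∷ G) ()

module _ {n : ℕ} (M : Matroid n) where

  rk-⊥ : rk M ⊥ ≡ 0
  rk-⊥ = ℕP.n≤0⇒n≡0 (subst (rk M ⊥ ≤_) (∣⊥∣≡0 n) (rk-bounded M ⊥))

  loopless⇒cl⊥≡⊥ : Loopless M → cl M ⊥ ≡ ⊥
  loopless⇒cl⊥≡⊥ loopless = tabulate-false (λ x → eqℕᵇ (rk M (⊥ ∪ ⁅ x ⁆)) (rk M ⊥)) not-in-cl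
    where
    tabulate-false : ∀ {m} (f : Fin m → _) → (∀ x → f x ≡ false) → tabulate f ≡ ⊥
    tabulate-false {zero}  f f≡false = refl
    tabulate-false {suc m} f f≡false = cong₂ _∷_ (f≡false zero) (tabulate-false (f ∘ suc) (f≡false ∘ suc))
    not-in-cl : ∀ x → eqℕᵇ (rk M (⊥ ∪ ⁅ x ⁆)) (rk M ⊥) ≡ false
    not-in-cl x rewrite ∪-identityˡ ⁅ x ⁆ | loopless x | rk-⊥ = refl

  rk-∪-⁅⁆-redundant : ∀ {F y} → rk M (F ∪ ⁅ y ⁆) ≤ rk M F →
    ∀ A → rk M ((A ∪ F) ∪ ⁅ y ⁆) ≡ rk M (A ∪ F)
  rk-∪-⁅⁆-redundant {F} {y} y∈clF A = ℕP.≤-antisym ≤-rk-A∪F (rk-mono M (p⊆p∪q ⁅ y ⁆))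
    where
    ∪-absorb : (A ∪ F) ∪ (F ∪ ⁅ y ⁆) ≡ (A ∪ F) ∪ ⁅ y ⁆
    ∪-absorb = begin
      (A ∪ F) ∪ (F ∪ ⁅ y ⁆) ≡⟨ ∪-assoc (A ∪ F) F ⁅ y ⁆ ⟨
      ((A ∪ F) ∪ F) ∪ ⁅ y ⁆ ≡⟨ cong (_∪ ⁅ y ⁆) (∪-assoc A F F) ⟩
      (A ∪ (F ∪ F)) ∪ ⁅ y ⁆ ≡⟨ cong (λ Z → (A ∪ Z) ∪ ⁅ y ⁆) (∪-idem F) ⟩
      (A ∪ F) ∪ ⁅ y ⁆       ∎
      where open ≡-Reasoning
    F⊆∩ : rk M F ≤ rk M ((A ∪ F) ∩ (F ∪ ⁅ y ⁆))
    F⊆∩ = rk-mono M (λ x∈F → x∈p∩q⁺ (q⊆p∪q A F x∈F , p⊆p∪q ⁅ y ⁆ x∈F))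
    ≤-rk-A∪F : rk M ((A ∪ F) ∪ ⁅ y ⁆) ≤ rk M (A ∪ F)
    ≤-rk-A∪F = ℕP.+-cancelʳ-≤ (rk M F) _ _ (begin
      rk M ((A ∪ F) ∪ ⁅ y ⁆) ℕ.+ rk M F
        ≤⟨ ℕP.+-monoʳ-≤ _ F⊆∩ ⟩
      rk M ((A ∪ F) ∪ ⁅ y ⁆) ℕ.+ rk M ((A ∪ F) ∩ (F ∪ ⁅ y ⁆))
        ≡⟨ cong (λ Z → rk M Z ℕ.+ rk M ((A ∪ F) ∩ (F ∪ ⁅ y ⁆))) ∪-absorb ⟨
      rk M ((A ∪ F) ∪ (F ∪ ⁅ y ⁆)) ℕ.+ rk M ((A ∪ F) ∩ (F ∪ ⁅ y ⁆))
        ≤⟨ rk-submod M (A ∪ F) (F ∪ ⁅ y ⁆) ⟩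
      rk M (A ∪ F) ℕ.+ rk M (F ∪ ⁅ y ⁆)
        ≤⟨ ℕP.+-monoʳ-≤ _ y∈clF ⟩
      rk M (A ∪ F) ℕ.+ rk M F ∎)
      where open ℕP.≤-Reasoning

  isFlat≡false⇒∃ : ∀ F → isFlat M F ≡ false →
    ∃ λ y → lookup F y ≡ false × rk M (F ∪ ⁅ y ⁆) ≤ rk M F
  isFlat≡false⇒∃ F = go (allFin n)
    where
    go : ∀ ys → allᵇ (λ x → (x ∈ᵇ F) ∨ ltᵇ (rk M F) (rk M (F ∪ ⁅ x ⁆))) ys ≡ false →
      ∃ λ y → lookup F y ≡ false × rk M (F ∪ ⁅ y ⁆) ≤ rk M F
    go (y ∷ ys) all≡false with lookup F y in y∈?F | rk M F ℕP.<? rk M (F ∪ ⁅ y ⁆)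
    ... | true  | _     = go ys all≡false
    ... | false | yes _ = go ys all≡false
    ... | false | no ≮  = y , y∈?F , ℕP.≮⇒≥ ≮

  alternatingSumAbove-nonFlat : ∀ (h : ℕ → ℤ) F → isFlat M F ≡ false →
    alternatingSumAbove (h ∘ rk M) F ≡ + 0
  alternatingSumAbove-nonFlat h F nonFlat with isFlat≡false⇒∃ F nonFlat
  ... | y , y∉F , y∈clF =
    x≡-x⇒x≡0 _ (trans (sumSubsets-toggle n y term)
                      (trans (sumSubsets-cong n term-toggle) (sumSubsets-neg n term)))
    where
    term : Subset n → ℤ
    term A = if does (A ⊆? (⊤ ─ F)) then sign ∣ A ∣ * h (rk M (A ∪ F)) else + 0
    rk-toggle : ∀ A → rk M (toggle y A ∪ F) ≡ rk M (A ∪ F)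
    rk-toggle A = begin
      rk M (toggle y A ∪ F)               ≡⟨ rk-∪-⁅⁆-redundant y∈clF (toggle y A) ⟨
      rk M ((toggle y A ∪ F) ∪ ⁅ y ⁆)     ≡⟨ cong (rk M) (toggle-∪-⁅⁆ y A F) ⟩
      rk M ((A ∪ F) ∪ ⁅ y ⁆)              ≡⟨ rk-∪-⁅⁆-redundant y∈clF A ⟩
      rk M (A ∪ F)                        ∎
      where open ≡-Reasoning
    term-toggle : ∀ A → term (toggle y A) ≡ - term A
    term-toggle A rewrite toggle-⊆? y A (⊤ ─ F) (∈-⊤─ F y y∉F) | sign-∣toggle∣ y A | rk-toggle A
      with does (A ⊆? (⊤ ─ F))
    ... | true  = sym (ℤP.neg-distribˡ-* (sign ∣ A ∣) _)
    ... | false = refl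

  qCorank : ℤ → Subset n → ℤ
  qCorank q B = qInt (rk M ⊤ ∸ rk M B) q

  eval-redCharPolyContract : ∀ q F →
    eval (redCharPolyContract M F) q ≡ alternatingSumAbove (qCorank q) F
  eval-redCharPolyContract q F = begin
    eval (divByQminus1 (charPolyOn G r)) q
      ≡⟨ eval-divByQminus1 q (charPolyOn G r) ⟩
    qIntEval q 0 (sumₚ (L.map term (subsetsOf G)))
      ≡⟨ qIntEval-sumₚ q 0 term (subsetsOf G) ⟩
    sumℤ (L.map (qIntEval q 0 ∘ term) (subsetsOf G))
      ≡⟨ sumℤ-map-filter (_⊆? G) (qIntEval q 0 ∘ term) (allSubsets n) ⟩
    sumSubsets n (λ A → if does (A ⊆? G) then qIntEval q 0 (term A) else + 0)
      ≡⟨ sumSubsets-cong n (λ A → cong (if does (A ⊆? G) then_else + 0) (eval-term A)) ⟩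
    alternatingSumAbove (qCorank q) F ∎
    where
    open ≡-Reasoning
    G = ⊤ ─ F
    r = contractRk M F
    term : Subset n → Poly
    term A = scaleₚ (sign ∣ A ∣) (monomial (r G ∸ r A))
    corank : ∀ A → (r G ∸ r A) ℕ.+ 0 ≡ rk M ⊤ ∸ rk M (A ∪ F)
    corank A rewrite ℕP.+-identityʳ (r G ∸ r A) | ⊤─p∪p≡⊤ F =
      ∸-∸-cancel (rk M ⊤) (rk M (A ∪ F)) (rk M F) (rk-mono M (q⊆p∪q A F))
    eval-term : ∀ A → qIntEval q 0 (term A) ≡ sign ∣ A ∣ * qInt (rk M ⊤ ∸ rk M (A ∪ F)) q
    eval-term A rewrite qIntEval-scaleₚ q 0 (sign ∣ A ∣) (monomial (r G ∸ r A))
                      | qIntEval-monomial q 0 (r G ∸ r A) | corank A = refl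

  lhs-summand : Loopless M → ∀ q F →
    (if isFlat M F ∧ not (F == ⊤) ∧ not (F == cl M ⊥)
     then + ∣ F ∣ * eval (redCharPolyContract M F) q else + 0)
    ≡ + ∣ F ∣ * alternatingSumAbove (qCorank q) F
  lhs-summand loopless q F with isFlat M F in flat | F == ⊤ in F≟⊤ | F == cl M ⊥ in F≟cl⊥
  ... | false | _     | _
    rewrite alternatingSumAbove-nonFlat (λ r → qInt (rk M ⊤ ∸ r) q) F flat = sym (ℤP.*-zeroʳ (+ ∣ F ∣))
  ... | true  | true  | _
    rewrite ==⇒≡ F ⊤ F≟⊤ | alternatingSumAbove-⊤ n (qCorank q) | ℕP.n∸n≡0 (rk M ⊤) =
    sym (ℤP.*-zeroʳ (+ ∣ ⊤ {n} ∣))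
  ... | true  | false | true
    rewrite ==⇒≡ F (cl M ⊥) F≟cl⊥ | loopless⇒cl⊥≡⊥ loopless | ∣⊥∣≡0 n = refl
  ... | true  | false | false = cong (+ ∣ F ∣ *_) (eval-redCharPolyContract q F)

corollary2p2 : (n : ℕ) (M : Matroid n) → Loopless M →
    (q : ℤ) → lhs M q ≡ (+ n) * qInt (rk M ⊤ ∸ 1) q
corollary2p2 n M loopless q = begin
  lhs M q
    ≡⟨ sumℤ-map-filter _ (λ F → + ∣ F ∣ * eval (redCharPolyContract M F) q) (allSubsets n) ⟩
  sumSubsets n (λ F → if isFlat M F ∧ not (F == ⊤) ∧ not (F == cl M ⊥)
                      then + ∣ F ∣ * eval (redCharPolyContract M F) q else + 0)
    ≡⟨ sumSubsets-cong n (lhs-summand M loopless q) ⟩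
  sumSubsets n (λ F → + ∣ F ∣ * alternatingSumAbove (qCorank M q) F)
    ≡⟨ sum-size*alternatingSumAbove n (qCorank M q) ⟩
  sumSingletons n (qCorank M q)
    ≡⟨ sumSingletons-const n (qCorank M q) _ (λ e → cong (λ r → qInt (rk M ⊤ ∸ r) q) (loopless e)) ⟩
  + n * qInt (rk M ⊤ ∸ 1) q ∎
  where open ≡-Reasoning
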